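{- Let $F\in\mathcal{F}_n$ with border vertices $V_0,\dots,V_{2n}$ and border height sequence $h_0\dots h_{2n}$, and let $R$ be a $321$-avoiding full rook placement on $F$. For $0\le i\le 2n$ let $\ell_i$ be the length of the longest increasing subsequence of the permutation determined by $R\cap\Gamma(V_i)$, and put $j_i=2\ell_i-h_i$. Then $j_0j_1\dots j_{2n}$ is the height sequence of a Dyck path $D_{R,F}\in\mathcal{D}_n$, and $j_i\le h_i$ for all $i$. Hence $(D_{R,F},D_F)\in\mathcal{D}^2_F$.
   Context: A Dyck path of semilength $n$ is a lattice path from $(0,n)$ to $(n,0)$ with unit east and south steps never going strictly below $y=n-x$; $\mathcal{D}_n$ is their set. $\mathcal{F}_n$ is the set of Ferrers boards (sets of unit squares bounded by the coordinate axes and a path) whose border $D_F$ is such a Dyck path; border vertices $V_0=(0,n),\dots,V_{2n}=(n,0)$ in order. The height sequence of a Dyck path is $d_0=0$, $d_{i+1}=d_i\pm1$ according as step $i+1$ is east ($+$) or south ($-$). $\mathcal{D}^2_F$ is the set of pairs $(D_0,D_F)$, $D_0\in\mathcal{D}_n$, with $D_0$ never strictly above $D_F$. A full rook placement $R$ on $F$ has exactly one square in each row and column of $F$; $\Gamma(V)$ for $V=(a,b)$ is the set of unit squares in $[0,a]\times[0,b]$; a set of squares with at most one per row and column determines a permutation by standardizing (columns read left to right, recording row ranks). $R$ is $\tau$-avoiding if for every border vertex $V$ the permutation determined by $R\cap\Gamma(V)$ avoids $\tau$. -}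

module Defs where

open import Data.Nat using (ℕ; zero; suc; _+_; _*_; _∸_; _≤_; _<_)
open import Data.Fin using (Fin; toℕ) renaming (zero to f0; suc to fs)
open import Data.List using (List; []; _∷_; take; length)
open import Data.Integer as ℤ using (ℤ; +_; _-_)
open import Data.Product using (Σ; _×_; ∃; _,_)
open import Function.Bundles using (_⇔_)
open import Relation.Binary.PropositionalEquality using (_≡_)

data Step : Set where
  E S : Step

countE : List Step → ℕ
countE []      = 0
countE (E ∷ w) = suc (countE w)
countE (S ∷ w) = countE w

countS : List Step → ℕ
countS []      = 0
countS (E ∷ w) = countS w
countS (S ∷ w) = suc (countS w)

xcoord : List Step → ℕ → ℕ
xcoord w i = countE (take i w)

ycoord : ℕ → List Step → ℕ → ℕ
ycoord n w i = n ∸ countS (take i w)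

-- Dyck path of semilength n: 2n unit E/S steps from (0,n) to (n,0),
-- never strictly below y = n - x, i.e. on every prefix
-- #S ≤ #E  (the vertex (a , n - s) satisfies n - s ≥ n - a).
record IsDyck (n : ℕ) (w : List Step) : Set where
  field
    len     : length w ≡ 2 * n
    ends    : countE w ≡ n
    noBelow : (i : ℕ) → countS (take i w) ≤ countE (take i w)

Dyck : ℕ → Set
Dyck n = Σ (List Step) (IsDyck n)

path : ∀ {n} → Dyck n → List Step
path (w , _) = w

height : ∀ {n} → Dyck n → Fin (suc (2 * n)) → ℤ
height (w , _) i = + countE (take (toℕ i) w) - + countS (take (toℕ i) w)

-- Both paths go from
-- (0,n) to (n,0); after i steps their vertices lie on the same
-- anti-diagonal x - y = i - n, on which being (weakly) lower means having
-- (weakly) smaller height.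
NeverAbove : ∀ {n} → Dyck n → Dyck n → Set
NeverAbove {n} D₀ D_F = (i : Fin (suc (2 * n))) → height D₀ i ℤ.≤ height D_F i

-- A Ferrers board F ∈ 𝓕_n is determined by its border D_F.  The unit
-- square with lower-left corner (c , r) (column c, row r) lies in
-- Γ(V) for V = (a , b) iff c < a and r < b.
InΓ : ℕ → ℕ → ℕ → ℕ → Set
InΓ a b c r = c < a × r < b

InΓV : (n : ℕ) → List Step → ℕ → ℕ → ℕ → Set
InΓV n w i c r = InΓ (xcoord w i) (ycoord n w i) c r

InBoard : ∀ {n} → Dyck n → ℕ → ℕ → Set
InBoard {n} (w , _) c r = ∃ λ i → i ≤ 2 * n × InΓV n w i c r

-- Since D_F is a Dyck path, F has exactly the columns 0..n-1 and rows
-- 0..n-1.  A full rook placement is thus given by a bijection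
-- σ : Fin n → Fin n (rook in column c at row σ c) with every rook in F.
record FullRookPlacement {n} (F : Dyck n) (σ : Fin n → Fin n) : Set where
  field
    injective : ∀ c d → σ c ≡ σ d → c ≡ d
    inBoard   : ∀ c → InBoard F (toℕ c) (toℕ (σ c))

record Selection {n} (F : Dyck n) (σ : Fin n → Fin n)
                 (i : Fin (suc (2 * n))) (k : ℕ) (c : Fin k → Fin n) : Set where
  field
    colsIncr : ∀ p q → toℕ p < toℕ q → toℕ (c p) < toℕ (c q)
    inΓ      : ∀ p → InΓV n (path F) (toℕ i) (toℕ (c p)) (toℕ (σ (c p)))

-- Standardisation
-- preserves relative order, so an occurrence is a selection whose row
-- values are order-isomorphic to τ.
ContainsAt : ∀ {n} (F : Dyck n) (σ : Fin n → Fin n)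
             (i : Fin (suc (2 * n))) {k : ℕ} (τ : Fin k → ℕ) → Set
ContainsAt F σ i {k} τ =
  Σ (Fin k → Fin _) λ c → Selection F σ i k c ×
    (∀ p q → (toℕ (σ (c p)) < toℕ (σ (c q))) ⇔ (τ p < τ q))

Avoiding : ∀ {n} (F : Dyck n) (σ : Fin n → Fin n) {k : ℕ} (τ : Fin k → ℕ) → Set
Avoiding {n} F σ τ = (i : Fin (suc (2 * n))) → ContainsAt F σ i τ → ⊥'
  where open import Data.Empty renaming (⊥ to ⊥')

τ321 : Fin 3 → ℕ
τ321 f0           = 3
τ321 (fs f0)      = 2
τ321 (fs (fs f0)) = 1

IncSubseq : ∀ {n} (F : Dyck n) (σ : Fin n → Fin n)
            (i : Fin (suc (2 * n))) (k : ℕ) → Set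
IncSubseq F σ i k =
  Σ (Fin k → Fin _) λ c → Selection F σ i k c ×
    (∀ p q → toℕ p < toℕ q → toℕ (σ (c p)) < toℕ (σ (c q)))

IsLIS : ∀ {n} (F : Dyck n) (σ : Fin n → Fin n)
        (i : Fin (suc (2 * n))) (ℓ : ℕ) → Set
IsLIS F σ i ℓ = IncSubseq F σ i ℓ × (∀ k → IncSubseq F σ i k → k ≤ ℓ)

-- Write V_i = (x_i , n - s_i), where x_i and s_i count the east and south steps of D_F before
-- V_i, so that h_i = x_i - s_i.  The n - x_i columns right of V_i carry rooks in distinct rows
-- below V_i, and so do the rooks of an increasing subsequence of R ∩ Γ(V_i); hence ℓ_i ≤ h_i,
-- i.e. j_i ≤ h_i.  Of the x_i columns left of V_i at most s_i carry a rook above V_i; the others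
-- form a 321-avoiding sequence, which is the union of its left-to-right maxima and the remaining
-- rooks, both increasing, so x_i - s_i ≤ 2ℓ_i, i.e. j_i ≥ 0.  A border step grows or shrinks
-- Γ(V_i) by one column or one row, so ℓ changes by 0 or 1 while h changes by ±1, and j changes
-- by ±1.  With j_0 = j_2n = 0 (forced by 0 ≤ j ≤ h) these are the heights of a Dyck path.

module Submission where

open import Defs
open import Data.Nat using (ℕ)
open import Data.Fin using (Fin)
open import Function.Definitions using (Injective)
open import Relation.Binary.PropositionalEquality using (_≡_)

module Lists where

  open import Data.Nat using (suc; _+_; _<_; s≤s)
  open import Data.Nat.Properties using (+-suc)
  open import Data.Fin using (toℕ) renaming (zero to fzero; suc to fsuc)
  open import Data.List using ([]; _∷_; length; lookup; filter)
  open import Data.List.Membership.Propositional.Properties using (∈-lookup)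
  open import Data.List.Relation.Unary.All as All using (All; []; _∷_)
  open import Data.List.Relation.Unary.AllPairs using (AllPairs; []; _∷_)
  open import Data.List.Relation.Binary.Sublist.Propositional using (_⊆_; []; _∷_; _∷ʳ_)
  open import Data.List.Relation.Binary.Sublist.Propositional.Properties using (All-resp-⊆)
  open import Relation.Unary using (Decidable)
  open import Relation.Nullary using (yes; no)
  open import Relation.Nullary.Decidable using (¬?)
  open import Relation.Binary.PropositionalEquality

  private variable
    A : Set

  AllPairs-resp-⊆ : ∀ {R : A → A → Set} {xs ys} → xs ⊆ ys → AllPairs R ys → AllPairs R xs
  AllPairs-resp-⊆ []         []        = []
  AllPairs-resp-⊆ (_ ∷ʳ τ)   (_ ∷ rs)  = AllPairs-resp-⊆ τ rs
  AllPairs-resp-⊆ (refl ∷ τ) (rx ∷ rs) = All-resp-⊆ τ rx ∷ AllPairs-resp-⊆ τ rs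

  AllPairs-lookup : ∀ {R : A → A → Set} {xs} → AllPairs R xs →
    ∀ {p q} → toℕ p < toℕ q → R (lookup xs p) (lookup xs q)
  AllPairs-lookup (rx ∷ _)  {fzero}  {fsuc q} _         = All.lookup rx (∈-lookup q)
  AllPairs-lookup (_ ∷ rs)  {fsuc p} {fsuc q} (s≤s p<q) = AllPairs-lookup rs p<q
  AllPairs-lookup (_ ∷ _)   {fzero}  {fzero}  ()
  AllPairs-lookup (_ ∷ _)   {fsuc _} {fzero}  ()

  length-filter+length-filter-∁ : ∀ {P : A → Set} (P? : Decidable P) xs →
    length (filter P? xs) + length (filter (λ x → ¬? (P? x)) xs) ≡ length xs
  length-filter+length-filter-∁ P? []       = refl
  length-filter+length-filter-∁ P? (x ∷ xs) with P? x
  ... | yes _ = cong suc (length-filter+length-filter-∁ P? xs)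
  ... | no  _ = trans (+-suc _ _) (cong suc (length-filter+length-filter-∁ P? xs))

module FinFacts where

  open import Data.Nat using (ℕ; _<_; s≤s)
  open import Data.Nat.Properties using (<-cmp; <-asym; <-irrefl)
  open import Data.Fin using (Fin; toℕ) renaming (zero to fzero; suc to fsuc)
  open import Data.Fin.Properties using (toℕ-injective)
  open import Data.Empty using (⊥-elim)
  open import Function.Bundles using (_⇔_; mk⇔)
  open import Function.Definitions using (Injective)
  open import Relation.Binary.Definitions using (tri<; tri≈; tri>)
  open import Relation.Binary.PropositionalEquality

  strictMono⇒injective : ∀ {m k} (g : Fin m → Fin k) →
    (∀ p q → toℕ p < toℕ q → toℕ (g p) < toℕ (g q)) → Injective _≡_ _≡_ g
  strictMono⇒injective g mono {p} {q} gp≡gq with <-cmp (toℕ p) (toℕ q)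
  ... | tri< p<q _ _ = ⊥-elim (<-irrefl (cong toℕ gp≡gq) (mono p q p<q))
  ... | tri≈ _ p≡q _ = toℕ-injective p≡q
  ... | tri> _ _ q<p = ⊥-elim (<-irrefl (cong toℕ (sym gp≡gq)) (mono q p q<p))

  antitone⇒<⇔> : ∀ {m} (f : Fin m → ℕ) → (∀ p q → toℕ p < toℕ q → f q < f p) →
    ∀ p q → (f p < f q) ⇔ (toℕ q < toℕ p)
  antitone⇒<⇔> f anti p q = mk⇔ to (anti q p)
    where
    to : f p < f q → toℕ q < toℕ p
    to fp<fq with <-cmp (toℕ p) (toℕ q)
    ... | tri< p<q _ _ = ⊥-elim (<-asym fp<fq (anti p q p<q))
    ... | tri≈ _ p≡q _ = ⊥-elim (<-irrefl (cong f (toℕ-injective p≡q)) fp<fq)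
    ... | tri> _ _ q<p = q<p

  ordered₃ : ∀ {A : Set} {_≺_ : A → A → Set} → (∀ {x y z} → x ≺ y → y ≺ z → x ≺ z) →
    (f : Fin 3 → A) → f fzero ≺ f (fsuc fzero) → f (fsuc fzero) ≺ f (fsuc (fsuc fzero)) →
    ∀ p q → toℕ p < toℕ q → f p ≺ f q
  ordered₃ _       _ ≺₀₁ _   fzero        (fsuc fzero)        _ = ≺₀₁
  ordered₃ ≺-trans _ ≺₀₁ ≺₁₂ fzero        (fsuc (fsuc fzero)) _ = ≺-trans ≺₀₁ ≺₁₂
  ordered₃ _       _ _   ≺₁₂ (fsuc fzero) (fsuc (fsuc fzero)) _ = ≺₁₂
  ordered₃ _ _ _ _ fzero               fzero               ()
  ordered₃ _ _ _ _ (fsuc fzero)        fzero               ()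
  ordered₃ _ _ _ _ (fsuc fzero)        (fsuc fzero)        (s≤s ())
  ordered₃ _ _ _ _ (fsuc (fsuc fzero)) fzero               ()
  ordered₃ _ _ _ _ (fsuc (fsuc fzero)) (fsuc fzero)        (s≤s ())
  ordered₃ _ _ _ _ (fsuc (fsuc fzero)) (fsuc (fsuc fzero)) (s≤s (s≤s ()))

module StepCounts where

  open import Data.Nat using (ℕ; zero; suc; _+_; _≤_; z≤n; s≤s)
  open import Data.Nat.Properties using (+-suc)
  open import Data.List using ([]; _∷_; take; length)
  open import Relation.Binary.PropositionalEquality

  countE+countS≡length : ∀ w → countE w + countS w ≡ length w
  countE+countS≡length []      = refl
  countE+countS≡length (E ∷ w) = cong suc (countE+countS≡length w)
  countE+countS≡length (S ∷ w) = trans (+-suc _ _) (cong suc (countE+countS≡length w))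

  countE-take-mono : ∀ w {i j} → i ≤ j → countE (take i w) ≤ countE (take j w)
  countE-take-mono []      {zero}          _         = z≤n
  countE-take-mono []      {suc _} {suc _} _         = z≤n
  countE-take-mono (_ ∷ _) {zero}          _         = z≤n
  countE-take-mono (E ∷ w) {suc _} {suc _} (s≤s i≤j) = s≤s (countE-take-mono w i≤j)
  countE-take-mono (S ∷ w) {suc _} {suc _} (s≤s i≤j) = countE-take-mono w i≤j

  countS-take-mono : ∀ w {i j} → i ≤ j → countS (take i w) ≤ countS (take j w)
  countS-take-mono []      {zero}          _         = z≤n
  countS-take-mono []      {suc _} {suc _} _         = z≤n
  countS-take-mono (_ ∷ _) {zero}          _         = z≤n
  countS-take-mono (E ∷ w) {suc _} {suc _} (s≤s i≤j) = countS-take-mono w i≤j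
  countS-take-mono (S ∷ w) {suc _} {suc _} (s≤s i≤j) = s≤s (countS-take-mono w i≤j)

  data VertexStep : ℕ → ℕ → ℕ → ℕ → Set where
    east  : ∀ {x s} → VertexStep x s (suc x) s
    south : ∀ {x s} → VertexStep x s x (suc s)

  sucˣ : ∀ {x s x′ s′} → VertexStep x s x′ s′ → VertexStep (suc x) s (suc x′) s′
  sucˣ east  = east
  sucˣ south = south

  sucˢ : ∀ {x s x′ s′} → VertexStep x s x′ s′ → VertexStep x (suc s) x′ (suc s′)
  sucˢ east  = east
  sucˢ south = south

  prefix-step : ∀ w {i} → suc i ≤ length w →
    VertexStep (countE (take i w)) (countS (take i w))
               (countE (take (suc i) w)) (countS (take (suc i) w))
  prefix-step (E ∷ w) {zero}  _         = east
  prefix-step (S ∷ w) {zero}  _         = south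
  prefix-step (E ∷ w) {suc i} (s≤s i<n) = sucˣ (prefix-step w i<n)
  prefix-step (S ∷ w) {suc i} (s≤s i<n) = sucˢ (prefix-step w i<n)

module Heights where

  open import Data.Nat as ℕ using (ℕ; suc; _*_; s≤s)
  open import Data.Nat.Properties as ℕ using (+-identityʳ; ≤-total; *-cancelˡ-≡)
  open import Data.Integer using (ℤ; +_; _+_; _-_; -_; _≤_; 0ℤ; 1ℤ; -1ℤ)
  import Data.Integer.Properties as ℤ
  import Data.Integer.Tactic.RingSolver as ℤ-Solver
  open import Data.Fin using (Fin; toℕ; fromℕ; fromℕ<; inject₁) renaming (zero to fzero; suc to fsuc)
  open import Data.Fin.Properties using (toℕ-fromℕ; toℕ-fromℕ<)
  open import Data.List using (List; _∷_; take; length; tabulate)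
  open import Data.List.Properties using (take-all; length-tabulate)
  open import Data.Product using (Σ; ∃-syntax; _,_; proj₁; proj₂)
  open import Data.Sum using (inj₁; inj₂)
  open import Function using (_∘_)
  open import Relation.Binary.PropositionalEquality
  open StepCounts

  stepHeight : Step → ℤ
  stepHeight E = 1ℤ
  stepHeight S = -1ℤ

  heightOf : List Step → ℤ
  heightOf w = + countE w - + countS w

  height-east : ∀ x s → + suc x - + s ≡ 1ℤ + (+ x - + s)
  height-east x s = ℤ.+-assoc 1ℤ (+ x) (- + s)

  height-south : ∀ x s → + x - + suc s ≡ -1ℤ + (+ x - + s)
  height-south x s = regroup (+ x) (+ s)
    where
    regroup : ∀ X S → X - (1ℤ + S) ≡ -1ℤ + (X - S)
    regroup = ℤ-Solver.solve-∀

  heightOf-∷ : ∀ s w → heightOf (s ∷ w) ≡ stepHeight s + heightOf w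
  heightOf-∷ E w = height-east (countE w) (countS w)
  heightOf-∷ S w = height-south (countE w) (countS w)

  heightOf≡0⇒countE≡countS : ∀ w → heightOf w ≡ 0ℤ → countE w ≡ countS w
  heightOf≡0⇒countE≡countS w h≡0 = ℤ.+-injective (ℤ.i-j≡0⇒i≡j _ _ h≡0)

  0≤heightOf⇒countS≤countE : ∀ w → 0ℤ ≤ heightOf w → countS w ℕ.≤ countE w
  0≤heightOf⇒countS≤countE w 0≤h = ℤ.drop‿+≤+ (ℤ.0≤i-j⇒j≤i 0≤h)

  heightOf-take-tabulate : ∀ {m} (f : Fin m → Step) (J : Fin (suc m) → ℤ) →
    (∀ k → J (fsuc k) ≡ stepHeight (f k) + J (inject₁ k)) →
    ∀ i → J fzero + heightOf (take (toℕ i) (tabulate f)) ≡ J i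
  heightOf-take-tabulate f J steps fzero = ℤ.+-identityʳ (J fzero)
  heightOf-take-tabulate {suc m} f J steps (fsuc i) = begin
    J fzero + heightOf (f fzero ∷ rest)              ≡⟨ cong (_+_ (J fzero)) (heightOf-∷ (f fzero) rest) ⟩
    J fzero + (stepHeight (f fzero) + heightOf rest) ≡⟨ ℤ.+-assoc (J fzero) _ _ ⟨
    J fzero + stepHeight (f fzero) + heightOf rest   ≡⟨ cong (_+ heightOf rest) first-step ⟩
    J (fsuc fzero) + heightOf rest                   ≡⟨ heightOf-take-tabulate (f ∘ fsuc) (J ∘ fsuc) (steps ∘ fsuc) i ⟩
    J (fsuc i)                                       ∎
    where
    open ≡-Reasoning
    rest : List Step
    rest = take (toℕ i) (tabulate (f ∘ fsuc))
    first-step : J fzero + stepHeight (f fzero) ≡ J (fsuc fzero)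
    first-step = trans (ℤ.+-comm (J fzero) _) (sym (steps fzero))

  dyckWithHeights : ∀ n (J : Fin (suc (2 * n)) → ℤ) →
    J fzero ≡ 0ℤ → J (fromℕ (2 * n)) ≡ 0ℤ → (∀ i → 0ℤ ≤ J i) →
    (∀ k → ∃[ s ] J (fsuc k) ≡ stepHeight s + J (inject₁ k)) →
    Σ (Dyck n) (λ D → ∀ i → height D i ≡ J i)
  dyckWithHeights n J start end nonneg steps = (w , isDyck) , heights
    where
    w : List Step
    w = tabulate (proj₁ ∘ steps)

    heights : ∀ i → heightOf (take (toℕ i) w) ≡ J i
    heights i = trans (sym (ℤ.+-identityˡ _))
                (trans (cong (_+ _) (sym start))
                       (heightOf-take-tabulate (proj₁ ∘ steps) J (proj₂ ∘ steps) i))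

    len : length w ≡ 2 * n
    len = length-tabulate _

    take≡w : ∀ {i} → 2 * n ℕ.≤ i → take i w ≡ w
    take≡w {i} 2n≤i = take-all i w (subst (ℕ._≤ i) (sym len) 2n≤i)

    height-w : heightOf w ≡ 0ℤ
    height-w = begin
      heightOf w                               ≡⟨ cong heightOf (take≡w (ℕ.≤-reflexive (sym (toℕ-fromℕ _)))) ⟨
      heightOf (take (toℕ (fromℕ (2 * n))) w)  ≡⟨ heights (fromℕ (2 * n)) ⟩
      J (fromℕ (2 * n))                        ≡⟨ end ⟩
      0ℤ                                       ∎
      where open ≡-Reasoning

    ends : countE w ≡ n
    ends = *-cancelˡ-≡ _ _ 2 (begin
      2 * countE w             ≡⟨ cong (countE w ℕ.+_) (+-identityʳ _) ⟩
      countE w ℕ.+ countE w    ≡⟨ cong (countE w ℕ.+_) (heightOf≡0⇒countE≡countS w height-w) ⟩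
      countE w ℕ.+ countS w    ≡⟨ countE+countS≡length w ⟩
      length w                 ≡⟨ len ⟩
      2 * n                    ∎)
      where open ≡-Reasoning

    noBelow : ∀ i → countS (take i w) ℕ.≤ countE (take i w)
    noBelow i with ≤-total i (2 * n)
    ... | inj₁ i≤2n = 0≤heightOf⇒countS≤countE (take i w)
          (subst (λ j → 0ℤ ≤ heightOf (take j w)) (toℕ-fromℕ< (s≤s i≤2n))
            (subst (0ℤ ≤_) (sym (heights (fromℕ< (s≤s i≤2n)))) (nonneg _)))
    ... | inj₂ 2n≤i rewrite take≡w 2n≤i =
          0≤heightOf⇒countS≤countE w (ℤ.≤-reflexive (sym height-w))

    isDyck : IsDyck n w
    isDyck = record { len = len ; ends = ends ; noBelow = noBelow }

module RookChains {n : ℕ} (σ : Fin n → Fin n) (σ-injective : Injective _≡_ _≡_ σ) where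

  open import Data.Nat using (zero; suc; _+_; _*_; _∸_; _≤_; _<_; z≤n; s≤s; s≤s⁻¹; _<?_)
  open import Data.Nat.Properties
  open import Data.Fin using (toℕ; fromℕ; fromℕ<; inject₁; inject≤; splitAt; join)
  open import Data.Fin.Properties
    using (toℕ-injective; toℕ-fromℕ; toℕ-fromℕ<; toℕ-inject₁; toℕ-inject≤; toℕ<n;
           join-splitAt; injective⇒≤)
  open import Data.List using (List; []; _∷_; length; lookup; filter; tabulate)
  open import Data.List.Properties using (length-tabulate)
  open import Data.List.Membership.Propositional.Properties using (∈-lookup)
  open import Data.List.Relation.Unary.All as All using (All; []; _∷_)
  open import Data.List.Relation.Unary.All.Properties as All using (all-filter)
  open import Data.List.Relation.Unary.AllPairs as AllPairs using (AllPairs; []; _∷_)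
  import Data.List.Relation.Unary.AllPairs.Properties as AllPairs
  open import Data.List.Relation.Binary.Sublist.Propositional using (_⊆_; []; _∷_; _∷ʳ_)
  open import Data.List.Relation.Binary.Sublist.Propositional.Properties using (All-resp-⊆)
  open import Data.Product as Product using (_×_; _,_; proj₁; proj₂; ∃-syntax)
  open import Data.Sum using (_⊎_; inj₁; inj₂; [_,_]′)
  open import Data.Empty using (⊥; ⊥-elim)
  open import Relation.Nullary using (Dec; yes; no)
  open import Relation.Nullary.Decidable using (¬?)
  open import Relation.Binary.Definitions using (tri<; tri≈; tri>)
  open import Function using (_∘_)
  open import Relation.Binary.PropositionalEquality
  open Lists
  open FinFacts

  col row : Fin n → ℕ
  col c = toℕ c
  row c = toℕ (σ c)

  Inside : ℕ → ℕ → Fin n → Set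
  Inside a b c = InΓ a b (col c) (row c)

  LeftOf Lower Rises : Fin n → Fin n → Set
  LeftOf c d = col c < col d
  Lower  c d = row c < row d
  Rises  c d = LeftOf c d × Lower c d

  rows-distinct : ∀ {c d} → LeftOf c d → row c ≢ row d
  rows-distinct c◁d r≡r = <-irrefl (cong toℕ (σ-injective (toℕ-injective r≡r))) c◁d

  record Chain (a b k : ℕ) : Set where
    field
      rook   : Fin k → Fin n
      col-<  : ∀ p q → toℕ p < toℕ q → col (rook p) < col (rook q)
      inside : ∀ p → Inside a b (rook p)
      row-<  : ∀ p q → toℕ p < toℕ q → row (rook p) < row (rook q)

  LongestChain : ℕ → ℕ → ℕ → Set
  LongestChain a b l = Chain a b l × (∀ {k} → Chain a b k → k ≤ l)

  Chain-mono : ∀ {a a′ b b′ k} → a ≤ a′ → b ≤ b′ → Chain a b k → Chain a′ b′ k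
  Chain-mono a≤a′ b≤b′ ch = record
    { rook   = rook
    ; col-<  = col-<
    ; inside = Product.map (λ c<a → <-≤-trans c<a a≤a′) (λ r<b → <-≤-trans r<b b≤b′) ∘ inside
    ; row-<  = row-<
    }
    where open Chain ch

  Chain-init : ∀ {a b k} → Chain (suc a) (suc b) (suc k) → Chain a b k
  Chain-init {k = k} ch = record
    { rook   = rook ∘ inject₁
    ; col-<  = λ p q → col-< (inject₁ p) (inject₁ q) ∘ inject₁-< p q
    ; inside = λ p → <-≤-trans (col-< _ _ (before-last p)) (s≤s⁻¹ (proj₁ (inside (fromℕ k))))
                   , <-≤-trans (row-< _ _ (before-last p)) (s≤s⁻¹ (proj₂ (inside (fromℕ k))))
    ; row-<  = λ p q → row-< (inject₁ p) (inject₁ q) ∘ inject₁-< p q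
    }
    where
    open Chain ch
    inject₁-< : ∀ p q → toℕ p < toℕ q → toℕ (inject₁ p) < toℕ (inject₁ q)
    inject₁-< p q = subst₂ _<_ (sym (toℕ-inject₁ p)) (sym (toℕ-inject₁ q))
    before-last : ∀ p → toℕ (inject₁ p) < toℕ (fromℕ k)
    before-last p = subst₂ _<_ (sym (toℕ-inject₁ p)) (sym (toℕ-fromℕ k)) (toℕ<n p)

  longest-adjacent : ∀ {a a′ b b′ l l′} → a ≤ a′ → a′ ≤ suc a → b ≤ b′ → b′ ≤ suc b →
    LongestChain a b l → LongestChain a′ b′ l′ → l ≤ l′ × l′ ≤ suc l
  longest-adjacent {a′ = a′} {b′ = b′} {l = l} a≤a′ a′≤1+a b≤b′ b′≤1+b
                   (ch , longest) (ch′ , longest′) =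
    longest′ (Chain-mono a≤a′ b≤b′ ch) , shorten _ ch′
    where
    shorten : ∀ k → Chain a′ b′ k → k ≤ suc l
    shorten zero    _  = z≤n
    shorten (suc k) ch = s≤s (longest (Chain-init (Chain-mono a′≤1+a b′≤1+b ch)))

  rows-within⇒≤ : ∀ {m lo hi} (g : Fin m → Fin n) → Injective _≡_ _≡_ g →
    (∀ p → lo ≤ row (g p)) → (∀ p → row (g p) < hi) → m ≤ hi ∸ lo
  rows-within⇒≤ {m} {lo} {hi} g g-injective lo≤ <hi = injective⇒≤ f-injective
    where
    f : Fin m → Fin (hi ∸ lo)
    f p = fromℕ< (∸-monoˡ-< (<hi p) (lo≤ p))
    f-injective : Injective _≡_ _≡_ f
    f-injective {p} {q} fp≡fq = g-injective (σ-injective (toℕ-injective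
      (∸-cancelʳ-≡ (lo≤ p) (lo≤ q)
        (trans (sym (toℕ-fromℕ< _)) (trans (cong toℕ fp≡fq) (toℕ-fromℕ< _))))))

  -- The chain and the n ∸ a columns right of a have distinct rows, all below b.
  Chain⇒k+[n∸a]≤b : ∀ {a b k} → a ≤ n → (∀ c → a ≤ col c → row c < b) →
    Chain a b k → k + (n ∸ a) ≤ b
  Chain⇒k+[n∸a]≤b {a} {b} {k} a≤n right-below ch =
    rows-within⇒≤ (columns ∘ splitAt k) (splitAt-injective ∘ columns-injective)
                  (λ _ → z≤n) (rows-below ∘ splitAt k)
    where
    open Chain ch
    a+j<n : (j : Fin (n ∸ a)) → a + toℕ j < n
    a+j<n j = subst (a + toℕ j <_) (m+[n∸m]≡n a≤n) (+-monoʳ-< a (toℕ<n j))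
    right : Fin (n ∸ a) → Fin n
    right j = fromℕ< (a+j<n j)
    col-right : ∀ j → col (right j) ≡ a + toℕ j
    col-right j = toℕ-fromℕ< (a+j<n j)
    columns : Fin k ⊎ Fin (n ∸ a) → Fin n
    columns = [ rook , right ]′
    rows-below : ∀ u → row (columns u) < b
    rows-below (inj₁ p) = proj₂ (inside p)
    rows-below (inj₂ j) = right-below (right j) (subst (a ≤_) (sym (col-right j)) (m≤m+n a (toℕ j)))
    rook≢right : ∀ p j → rook p ≢ right j
    rook≢right p j eq = <-irrefl (trans (cong toℕ eq) (col-right j))
                                 (<-≤-trans (proj₁ (inside p)) (m≤m+n a (toℕ j)))
    columns-injective : Injective _≡_ _≡_ columns
    columns-injective {inj₁ p} {inj₁ q} eq = cong inj₁ (strictMono⇒injective rook col-< eq)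
    columns-injective {inj₁ p} {inj₂ j} eq = ⊥-elim (rook≢right p j eq)
    columns-injective {inj₂ j} {inj₁ p} eq = ⊥-elim (rook≢right p j (sym eq))
    columns-injective {inj₂ i} {inj₂ j} eq = cong inj₂ (toℕ-injective (+-cancelˡ-≡ a _ _
      (trans (sym (col-right i)) (trans (cong toℕ eq) (col-right j)))))
    splitAt-injective : Injective _≡_ _≡_ (splitAt k {n ∸ a})
    splitAt-injective {p} {q} eq =
      trans (sym (join-splitAt k _ p)) (trans (cong (join k _) eq) (join-splitAt k _ q))

  Avoids321 : ℕ → ℕ → Set
  Avoids321 a b = ∀ {p q r} → Inside a b p → Inside a b q → Inside a b r →
                  LeftOf p q → LeftOf q r → Lower r q → Lower q p → ⊥

  splitMaxima : Fin n → List (Fin n) → List (Fin n) × List (Fin n)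
  splitMaxima M []       = [] , []
  splitMaxima M (c ∷ cs) with row M <? row c
  ... | yes _ = Product.map₁ (c ∷_) (splitMaxima c cs)
  ... | no  _ = Product.map₂ (c ∷_) (splitMaxima M cs)

  maxima rest : Fin n → List (Fin n) → List (Fin n)
  maxima M cs = proj₁ (splitMaxima M cs)
  rest   M cs = proj₂ (splitMaxima M cs)

  length-splitMaxima : ∀ M cs → length (maxima M cs) + length (rest M cs) ≡ length cs
  length-splitMaxima M []       = refl
  length-splitMaxima M (c ∷ cs) with row M <? row c
  ... | yes _ = cong suc (length-splitMaxima c cs)
  ... | no  _ = trans (+-suc _ _) (cong suc (length-splitMaxima M cs))

  splitMaxima-⊆ : ∀ M cs → maxima M cs ⊆ cs × rest M cs ⊆ cs
  splitMaxima-⊆ M []       = [] , []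
  splitMaxima-⊆ M (c ∷ cs) with row M <? row c
  ... | yes _ = Product.map (refl ∷_) (c ∷ʳ_) (splitMaxima-⊆ c cs)
  ... | no  _ = Product.map (c ∷ʳ_) (refl ∷_) (splitMaxima-⊆ M cs)

  maxima-rise : ∀ M cs → All (Lower M) (maxima M cs) × AllPairs Lower (maxima M cs)
  maxima-rise M []       = [] , []
  maxima-rise M (c ∷ cs) with row M <? row c
  ... | yes M<c = let above , rising = maxima-rise c cs
                  in M<c ∷ All.map (<-trans M<c) above , above ∷ rising
  ... | no  _   = maxima-rise M cs

  Dominated : ℕ → ℕ → Fin n → Set
  Dominated a b c = ∃[ M ] Inside a b M × LeftOf M c × Lower c M

  rest-dominated : ∀ {a b} M cs → Inside a b M → All (Inside a b) cs → All (LeftOf M) cs →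
    AllPairs LeftOf cs → All (Dominated a b) (rest M cs)
  rest-dominated M []       _    _            _            _                = []
  rest-dominated M (c ∷ cs) in-M (in-c ∷ ins) (M◁c ∷ M◁cs) (c◁cs ∷ sorted) with row M <? row c
  ... | yes _   = rest-dominated c cs in-c ins c◁cs sorted
  ... | no  M≮c = (M , in-M , M◁c , ≤∧≢⇒< (≮⇒≥ M≮c) (rows-distinct M◁c ∘ sym))
                  ∷ rest-dominated M cs in-M ins M◁cs sorted

  -- Two dominated rooks in decreasing order would complete a 321 with the dominator of the first.
  dominated⇒rising : ∀ {a b cs} → Avoids321 a b → All (Inside a b) cs → All (Dominated a b) cs →
    AllPairs LeftOf cs → AllPairs Rises cs
  dominated⇒rising avoid [] [] [] = []
  dominated⇒rising {cs = c ∷ _} avoid (in-c ∷ ins) ((M , in-M , M◁c , c<M) ∷ doms) (c◁cs ∷ sorted) =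
    All.zipWith rises (ins , c◁cs) ∷ dominated⇒rising avoid ins doms sorted
    where
    rises : ∀ {d} → Inside _ _ d × LeftOf c d → Rises c d
    rises {d} (in-d , c◁d) with <-cmp (row c) (row d)
    ... | tri< c<d _ _ = c◁d , c<d
    ... | tri≈ _ c≡d _ = ⊥-elim (rows-distinct c◁d c≡d)
    ... | tri> _ _ d<c = ⊥-elim (avoid in-M in-c in-d M◁c c◁d d<c c<M)

  toChain : ∀ {a b} cs → AllPairs Rises cs → All (Inside a b) cs → Chain a b (length cs)
  toChain cs rising ins = record
    { rook   = lookup cs
    ; col-<  = λ _ _ p<q → proj₁ (AllPairs-lookup rising p<q)
    ; inside = λ p → All.lookup ins (∈-lookup p)
    ; row-<  = λ _ _ p<q → proj₂ (AllPairs-lookup rising p<q)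
    }

  longer : ∀ {a b k₁ k₂} → Chain a b k₁ → Chain a b k₂ → ∃[ k ] Chain a b k × k₁ + k₂ ≤ 2 * k
  longer {k₁ = k₁} {k₂} ch₁ ch₂ with ≤-total k₁ k₂
  ... | inj₁ k₁≤k₂ = k₂ , ch₂ , +-mono-≤ k₁≤k₂ (m≤m+n k₂ 0)
  ... | inj₂ k₂≤k₁ = k₁ , ch₁ , +-monoʳ-≤ k₁ (≤-trans k₂≤k₁ (m≤m+n k₁ 0))

  -- A 321-free sequence is the union of its left-to-right maxima and the rest, both increasing.
  half≤chain : ∀ {a b} → Avoids321 a b → ∀ cs → AllPairs LeftOf cs → All (Inside a b) cs →
    ∃[ k ] Chain a b k × length cs ≤ 2 * k
  half≤chain avoid []       _                _            = 0 , toChain [] [] [] , z≤n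
  half≤chain avoid (c ∷ cs) (c◁cs ∷ sorted) (in-c ∷ ins) =
    let k , ch , ≤2k = longer (toChain (c ∷ maxima c cs) maxima-rising (in-c ∷ All-resp-⊆ max⊆ ins))
                              (toChain (rest c cs) rest-rising (All-resp-⊆ rest⊆ ins))
    in k , ch , subst (_≤ 2 * k) (cong suc (length-splitMaxima c cs)) ≤2k
    where
    max⊆ : maxima c cs ⊆ cs
    max⊆ = proj₁ (splitMaxima-⊆ c cs)
    rest⊆ : rest c cs ⊆ cs
    rest⊆ = proj₂ (splitMaxima-⊆ c cs)
    maxima-rising : AllPairs Rises (c ∷ maxima c cs)
    maxima-rising = All.zip (All-resp-⊆ max⊆ c◁cs , proj₁ (maxima-rise c cs))
                  ∷ AllPairs.zip (AllPairs-resp-⊆ max⊆ sorted , proj₂ (maxima-rise c cs))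
    rest-rising : AllPairs Rises (rest c cs)
    rest-rising = dominated⇒rising avoid (All-resp-⊆ rest⊆ ins)
                    (rest-dominated c cs in-c ins c◁cs sorted) (AllPairs-resp-⊆ rest⊆ sorted)

  -- Of the a columns left of a, those with rook below b form a 321-free sequence in Γ(a , b),
  -- and the others have distinct rows in [b , n).
  Avoids321⇒a≤2k+[n∸b] : ∀ {a b} → a ≤ n → Avoids321 a b →
    ∃[ k ] Chain a b k × a ≤ 2 * k + (n ∸ b)
  Avoids321⇒a≤2k+[n∸b] {a} {b} a≤n avoid =
    let k , ch , low≤2k = half≤chain avoid low low-sorted low-inside
    in k , ch , ≤-trans (≤-reflexive a≡low+high) (+-mono-≤ low≤2k high≤n∸b)
    where
    columns : List (Fin n)
    columns = tabulate (λ j → inject≤ j a≤n)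
    columns-sorted : AllPairs LeftOf columns
    columns-sorted = AllPairs.tabulate⁺-< λ {i} {j} i<j →
      subst₂ _<_ (sym (toℕ-inject≤ i a≤n)) (sym (toℕ-inject≤ j a≤n)) i<j
    columns-left : All (λ c → col c < a) columns
    columns-left = All.tabulate⁺ λ j → subst (_< a) (sym (toℕ-inject≤ j a≤n)) (toℕ<n j)
    below? : ∀ c → Dec (row c < b)
    below? c = row c <? b
    low high : List (Fin n)
    low  = filter below? columns
    high = filter (¬? ∘ below?) columns
    low-sorted : AllPairs LeftOf low
    low-sorted = AllPairs.filter⁺ below? columns-sorted
    low-inside : All (Inside a b) low
    low-inside = All.zip (All.filter⁺ below? columns-left , all-filter below? columns)
    high≤n∸b : length high ≤ n ∸ b
    high≤n∸b = rows-within⇒≤ (lookup high)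
      (strictMono⇒injective (lookup high)
        (λ _ _ → AllPairs-lookup (AllPairs.filter⁺ (¬? ∘ below?) columns-sorted)))
      (λ p → ≮⇒≥ (All.lookup (all-filter (¬? ∘ below?) columns) (∈-lookup p)))
      (λ p → toℕ<n (σ (lookup high p)))
    a≡low+high : a ≡ length low + length high
    a≡low+high = trans (sym (length-tabulate _)) (sym (length-filter+length-filter-∁ below? columns))

module LisHeight where

  open import Data.Nat as ℕ using (ℕ; suc; _*_)
  open import Data.Nat.Properties as ℕ using (m≤n⇒m<n∨m≡n)
  open import Data.Integer using (ℤ; +_; _+_; _-_; _≤_; +≤+; 0ℤ; 1ℤ; -1ℤ)
  import Data.Integer.Properties as ℤ
  import Data.Integer.Tactic.RingSolver as ℤ-Solver
  open import Data.Product using (∃-syntax; _,_)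
  open import Data.Sum using (_⊎_; inj₁; inj₂)
  open import Relation.Binary.PropositionalEquality
  open Heights using (stepHeight)

  lisHeight : ℕ → ℤ → ℤ
  lisHeight l h = + (2 * l) - h

  ≤∧≤suc⇒≡∨≡suc : ∀ {m n} → m ℕ.≤ n → n ℕ.≤ suc m → n ≡ m ⊎ n ≡ suc m
  ≤∧≤suc⇒≡∨≡suc m≤n n≤1+m with m≤n⇒m<n∨m≡n n≤1+m
  ... | inj₁ n<1+m = inj₁ (ℕ.≤-antisym (ℕ.s≤s⁻¹ n<1+m) m≤n)
  ... | inj₂ n≡1+m = inj₂ n≡1+m

  lisHeight-east : ∀ {l l′} h → l ℕ.≤ l′ → l′ ℕ.≤ suc l →
    ∃[ s ] lisHeight l′ (1ℤ + h) ≡ stepHeight s + lisHeight l h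
  lisHeight-east {l} h l≤l′ l′≤1+l with ≤∧≤suc⇒≡∨≡suc l≤l′ l′≤1+l
  ... | inj₁ refl = S , stay (+ l) h
    where
    stay : ∀ L h → (L + (L + 0ℤ)) - (1ℤ + h) ≡ -1ℤ + ((L + (L + 0ℤ)) - h)
    stay = ℤ-Solver.solve-∀
  ... | inj₂ refl = E , grow (+ l) h
    where
    grow : ∀ L h → ((1ℤ + L) + ((1ℤ + L) + 0ℤ)) - (1ℤ + h) ≡ 1ℤ + ((L + (L + 0ℤ)) - h)
    grow = ℤ-Solver.solve-∀

  lisHeight-south : ∀ {l l′} h → l′ ℕ.≤ l → l ℕ.≤ suc l′ →
    ∃[ s ] lisHeight l′ (-1ℤ + h) ≡ stepHeight s + lisHeight l h
  lisHeight-south {l′ = l′} h l′≤l l≤1+l′ with ≤∧≤suc⇒≡∨≡suc l′≤l l≤1+l′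
  ... | inj₁ refl = E , stay (+ l′) h
    where
    stay : ∀ L h → (L + (L + 0ℤ)) - (-1ℤ + h) ≡ 1ℤ + ((L + (L + 0ℤ)) - h)
    stay = ℤ-Solver.solve-∀
  ... | inj₂ refl = S , shrink (+ l′) h
    where
    shrink : ∀ L h → (L + (L + 0ℤ)) - (-1ℤ + h) ≡ -1ℤ + (((1ℤ + L) + ((1ℤ + L) + 0ℤ)) - h)
    shrink = ℤ-Solver.solve-∀

  0≤lisHeight : ∀ {l x s} → x ℕ.≤ 2 * l ℕ.+ s → 0ℤ ≤ lisHeight l (+ x - + s)
  0≤lisHeight {l} {x} {s} x≤2l+s =
    subst (0ℤ ≤_) (regroup (+ (2 * l)) (+ s) (+ x)) (ℤ.i≤j⇒0≤j-i (+≤+ x≤2l+s))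
    where
    regroup : ∀ L S X → (L + S) - X ≡ L - (X - S)
    regroup = ℤ-Solver.solve-∀

  lisHeight≤height : ∀ {l x s} → l ℕ.+ s ℕ.≤ x → lisHeight l (+ x - + s) ≤ + x - + s
  lisHeight≤height {l} {x} {s} l+s≤x = ℤ.0≤i-j⇒j≤i
    (subst (0ℤ ≤_) (regroup (+ l) (+ s) (+ x)) (ℤ.+-mono-≤ 0≤x-l-s 0≤x-l-s))
    where
    0≤x-l-s : 0ℤ ≤ + x - + (l ℕ.+ s)
    0≤x-l-s = ℤ.i≤j⇒0≤j-i (+≤+ l+s≤x)
    regroup : ∀ L S X → (X - (L + S)) + (X - (L + S)) ≡ (X - S) - ((L + (L + 0ℤ)) - (X - S))
    regroup = ℤ-Solver.solve-∀

module Border {n : ℕ} (F : Dyck n) (σ : Fin n → Fin n) (R : FullRookPlacement F σ) where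

  open import Data.Nat using (zero; suc; _+_; _*_; _∸_; _≤_; _<_; z≤n)
  open import Data.Nat.Properties
  open import Data.Integer as ℤ using (ℤ; +_; _-_; 0ℤ)
  import Data.Integer.Properties as ℤ
  open import Data.Fin using (toℕ; fromℕ; inject₁) renaming (zero to fzero; suc to fsuc)
  open import Data.Fin.Properties using (toℕ-fromℕ; toℕ-inject₁; toℕ<n; toℕ≤pred[n])
  open import Data.List using (List; take; length)
  open import Data.List.Properties using (take-all)
  open import Data.Product using (_,_; proj₂; ∃-syntax)
  open import Data.Sum using (inj₁; inj₂)
  open import Data.Empty using (⊥-elim)
  open import Function using (_∘_)
  open import Relation.Binary.PropositionalEquality
  open import Function.Bundles using (_⇔_)
  import Function.Properties.Equivalence as ⇔
  open IsDyck (proj₂ F)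
  open FullRookPlacement R
  open StepCounts
  open Heights using (stepHeight; height-east; height-south)
  open LisHeight
  open FinFacts using (antitone⇒<⇔>; ordered₃)
  open RookChains σ (λ {c} {d} → injective c d)

  w : List Step
  w = path F

  x s y : ℕ → ℕ
  x i = countE (take i w)
  s i = countS (take i w)
  y i = n ∸ s i

  h : ℕ → ℤ
  h i = + x i - + s i

  take-2n : take (2 * n) w ≡ w
  take-2n = take-all (2 * n) w (≤-reflexive len)

  countS≡n : countS w ≡ n
  countS≡n = +-cancelˡ-≡ n _ _ (begin
    n + countS w          ≡⟨ cong (_+ countS w) ends ⟨
    countE w + countS w   ≡⟨ countE+countS≡length w ⟩
    length w              ≡⟨ len ⟩
    2 * n                 ≡⟨ cong (_+_ n) (+-identityʳ n) ⟩
    n + n                 ∎)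
    where open ≡-Reasoning

  x≤n : ∀ {i} → i ≤ 2 * n → x i ≤ n
  x≤n i≤2n = ≤-trans (countE-take-mono w i≤2n) (≤-reflexive (trans (cong countE take-2n) ends))

  s≤n : ∀ {i} → i ≤ 2 * n → s i ≤ n
  s≤n i≤2n = ≤-trans (countS-take-mono w i≤2n) (≤-reflexive (trans (cong countS take-2n) countS≡n))

  h-end : h (toℕ (fromℕ (2 * n))) ≡ 0ℤ
  h-end rewrite toℕ-fromℕ (2 * n) | take-2n = ℤ.i≡j⇒i-j≡0 (cong +_ (trans ends (sym countS≡n)))

  -- A rook in a column right of the vertex V_i lies in some Γ(V_j) with j > i, hence below V_i.
  right-of-vertex-below : ∀ i c → x i ≤ col c → row c < y i
  right-of-vertex-below i c xi≤c with inBoard c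
  ... | j , _ , c<xj , r<yj with ≤-total i j
  ...   | inj₁ i≤j = <-≤-trans r<yj (∸-monoʳ-≤ n (countS-take-mono w i≤j))
  ...   | inj₂ j≤i = ⊥-elim (<-irrefl refl (<-≤-trans (<-≤-trans c<xj (countE-take-mono w j≤i)) xi≤c))

  longestAt : ∀ {i l} → IsLIS F σ i l → LongestChain (x (toℕ i)) (y (toℕ i)) l
  longestAt ((c , sel , rising) , longest) =
      record { rook = c ; col-< = colsIncr ; inside = inΓ ; row-< = rising }
    , λ ch → let open Chain ch in longest _ (rook , record { colsIncr = col-< ; inΓ = inside } , row-<)
    where open Selection sel

  avoidsAt : Avoiding F σ τ321 → ∀ i → Avoids321 (x (toℕ i)) (y (toℕ i))
  avoidsAt avoiding i {p} {q} {r} in-p in-q in-r p◁q q◁r r<q q<p =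
    avoiding i (triple , selection , order-iso)
    where
    triple : Fin 3 → Fin n
    triple fzero               = p
    triple (fsuc fzero)        = q
    triple (fsuc (fsuc fzero)) = r
    inside : ∀ t → Inside _ _ (triple t)
    inside fzero               = in-p
    inside (fsuc fzero)        = in-q
    inside (fsuc (fsuc fzero)) = in-r
    selection : Selection F σ i 3 triple
    selection = record { colsIncr = ordered₃ {_≺_ = _<_} <-trans (toℕ ∘ triple) p◁q q◁r ; inΓ = inside }
    decreasing : (f : Fin 3 → ℕ) → f (fsuc fzero) < f fzero → f (fsuc (fsuc fzero)) < f (fsuc fzero) →
      ∀ t u → toℕ t < toℕ u → f u < f t
    decreasing f = ordered₃ {_≺_ = λ a b → b < a} (λ b<a c<b → <-trans c<b b<a) f
    order-iso : ∀ t u → (row (triple t) < row (triple u)) ⇔ (τ321 t < τ321 u)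
    order-iso t u = ⇔.trans (antitone⇒<⇔> (row ∘ triple) (decreasing (row ∘ triple) q<p r<q) t u)
                            (⇔.sym (antitone⇒<⇔> τ321 (decreasing τ321 (n<1+n 2) (n<1+n 1)) t u))

  l+s≤x : ∀ {i l} → i ≤ 2 * n → LongestChain (x i) (y i) l → l + s i ≤ x i
  l+s≤x {i} {l} i≤2n (ch , _) = +-cancelʳ-≤ (n ∸ x i) (l + s i) (x i) (begin
    l + s i + (n ∸ x i)    ≡⟨ +-assoc l (s i) _ ⟩
    l + (s i + (n ∸ x i))  ≡⟨ cong (_+_ l) (+-comm (s i) _) ⟩
    l + ((n ∸ x i) + s i)  ≡⟨ +-assoc l _ (s i) ⟨
    l + (n ∸ x i) + s i    ≤⟨ +-monoˡ-≤ (s i) chain+right≤y ⟩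
    (n ∸ s i) + s i        ≡⟨ m∸n+n≡m (s≤n i≤2n) ⟩
    n                      ≡⟨ m+[n∸m]≡n (x≤n i≤2n) ⟨
    x i + (n ∸ x i)        ∎)
    where
    open ≤-Reasoning
    chain+right≤y : l + (n ∸ x i) ≤ y i
    chain+right≤y = Chain⇒k+[n∸a]≤b (x≤n i≤2n) (right-of-vertex-below i) ch

  x≤2l+s : ∀ {i l} → i ≤ 2 * n → Avoids321 (x i) (y i) → LongestChain (x i) (y i) l →
    x i ≤ 2 * l + s i
  x≤2l+s i≤2n avoid (_ , longest) with Avoids321⇒a≤2k+[n∸b] (x≤n i≤2n) avoid
  ... | k , ch , x≤2k+[n∸y] =
    ≤-trans x≤2k+[n∸y] (+-mono-≤ (*-monoʳ-≤ 2 (longest ch))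
                                  (≤-reflexive (m∸[m∸n]≡n (s≤n i≤2n))))

  ∸-suc-≤ : ∀ m k → m ∸ k ≤ suc (m ∸ suc k)
  ∸-suc-≤ zero    k       rewrite 0∸n≡0 k = z≤n
  ∸-suc-≤ (suc m) zero    = ≤-refl
  ∸-suc-≤ (suc m) (suc k) = ∸-suc-≤ m k

  lisHeight-vertexStep : ∀ {x s x′ s′ l l′} → VertexStep x s x′ s′ →
    LongestChain x (n ∸ s) l → LongestChain x′ (n ∸ s′) l′ →
    ∃[ st ] lisHeight l′ (+ x′ - + s′) ≡ stepHeight st ℤ.+ lisHeight l (+ x - + s)
  lisHeight-vertexStep {x} {s} east long long′ rewrite height-east x s =
    let l≤l′ , l′≤1+l = longest-adjacent (n≤1+n x) ≤-refl ≤-refl (n≤1+n _) long long′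
    in lisHeight-east (+ x - + s) l≤l′ l′≤1+l
  lisHeight-vertexStep {x} {s} south long long′ rewrite height-south x s =
    let l′≤l , l≤1+l′ = longest-adjacent ≤-refl (n≤1+n x) (∸-monoʳ-≤ n (n≤1+n s)) (∸-suc-≤ n s)
                                         long′ long
    in lisHeight-south (+ x - + s) l′≤l l≤1+l′

  lisHeight≤h : ∀ i {l} → IsLIS F σ i l → lisHeight l (h (toℕ i)) ℤ.≤ h (toℕ i)
  lisHeight≤h i {l} lis =
    lisHeight≤height {l} {x (toℕ i)} {s (toℕ i)} (l+s≤x (toℕ≤pred[n] i) (longestAt lis))

  0≤lisHeight-h : Avoiding F σ τ321 → ∀ i {l} → IsLIS F σ i l → 0ℤ ℤ.≤ lisHeight l (h (toℕ i))
  0≤lisHeight-h avoiding i {l} lis =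
    0≤lisHeight {l} {x (toℕ i)} {s (toℕ i)} (x≤2l+s (toℕ≤pred[n] i) (avoidsAt avoiding i) (longestAt lis))

  lisHeight-step : (ℓ : Fin (suc (2 * n)) → ℕ) → (∀ i → IsLIS F σ i (ℓ i)) → ∀ k →
    ∃[ st ] lisHeight (ℓ (fsuc k)) (h (toℕ (fsuc k)))
            ≡ stepHeight st ℤ.+ lisHeight (ℓ (inject₁ k)) (h (toℕ (inject₁ k)))
  lisHeight-step ℓ lis k with toℕ (inject₁ k) | toℕ-inject₁ k | longestAt (lis (inject₁ k))
  ... | _ | refl | long =
    lisHeight-vertexStep (prefix-step w (subst (suc (toℕ k) ≤_) (sym len) (toℕ<n k)))
                         long (longestAt (lis (fsuc k)))

open import Data.Nat using (ℕ; suc; _*_)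
open import Data.Fin using (Fin; fromℕ) renaming (zero to fzero)
open import Data.Integer using (ℤ; +_; _-_; _≤_; 0ℤ)
import Data.Integer.Properties as ℤ
open import Data.Product using (Σ; _×_; _,_)
open import Relation.Binary.PropositionalEquality using (_≡_)

lemma3p3 : (n : ℕ) (F : Dyck n) (σ : Fin n → Fin n)
    → FullRookPlacement F σ
    → Avoiding F σ τ321
    → (ℓ : Fin (suc (2 * n)) → ℕ)
    → ((i : Fin (suc (2 * n))) → IsLIS F σ i (ℓ i))
    → Σ (Dyck n) (λ D →
        ((i : Fin (suc (2 * n))) → height D i ≡ + (2 * ℓ i) - height F i)
        × ((i : Fin (suc (2 * n))) → + (2 * ℓ i) - height F i ≤ height F i)
        × NeverAbove D F)
lemma3p3 n F σ R avoiding ℓ lis =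
  let D , heights = Heights.dyckWithHeights n J J-start J-end nonneg (lisHeight-step ℓ lis)
  in D , heights , below , λ i → subst (_≤ height F i) (sym (heights i)) (below i)
  where
  open Border F σ R
  open LisHeight
  open Relation.Binary.PropositionalEquality using (subst; sym)

  J : Fin (suc (2 * n)) → ℤ
  J i = lisHeight (ℓ i) (height F i)

  below : ∀ i → J i ≤ height F i
  below i = lisHeight≤h i (lis i)

  nonneg : ∀ i → 0ℤ ≤ J i
  nonneg i = 0≤lisHeight-h avoiding i (lis i)

  J-start : J fzero ≡ 0ℤ
  J-start = ℤ.≤-antisym (below fzero) (nonneg fzero)

  J-end : J (fromℕ (2 * n)) ≡ 0ℤ
  J-end = ℤ.≤-antisym (ℤ.≤-trans (below (fromℕ (2 * n))) (ℤ.≤-reflexive h-end))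
                      (nonneg (fromℕ (2 * n)))
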